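{- Let $L$ and $R$ be two oriented graphs. If $\operatorname{inv}(L) = \operatorname{inv}(R) = 1$, then $\operatorname{inv}(L\rightarrow R) = 2$.
   Context: An oriented graph is a digraph with no loops, no multiple arcs and no directed cycle of length 2. Inverting a vertex set $X$ means reversing every arc with both ends in $X$. $\operatorname{inv}(D)$ is the minimum number of successive inversions needed to make the oriented graph $D$ acyclic. The dijoin $L\rightarrow R$ is obtained from the disjoint union of $L$ and $R$ by adding all arcs from $V(L)$ to $V(R)$. -}

module Defs where

open import Data.Nat using (ℕ; zero; suc; _+_; _<_)
open import Data.Fin using (Fin; splitAt)
open import Data.Bool using (Bool; true; false; _∧_; if_then_else_)
open import Data.Sum using (_⊎_; inj₁; inj₂)
open import Data.Vec using (Vec; []; _∷_)
open import Data.Product using (∃; _×_)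
open import Relation.Nullary using (¬_)
open import Relation.Binary.PropositionalEquality using (_≡_)

record Digraph : Set where
  constructor digraph
  field
    size : ℕ
    arc  : Fin size → Fin size → Bool
open Digraph public

-- Oriented graph: no loops, no 2-cycles (no multiple arcs is automatic).
IsOriented : Digraph → Set
IsOriented D = (∀ u → arc D u u ≡ false)
             × (∀ u v → arc D u v ≡ true → arc D v u ≡ false)

VSet : Digraph → Set
VSet D = Fin (size D) → Bool

invert : (D : Digraph) → VSet D → Digraph
invert D X = digraph (size D)
  (λ u v → if X u ∧ X v then arc D v u else arc D u v)

invertAll : (D : Digraph) → ∀ {k} → Vec (VSet D) k → Digraph
invertAll D [] = D
invertAll D (X ∷ Xs) = invertAll (invert D X) Xs

data Walk (D : Digraph) : Fin (size D) → Fin (size D) → Set where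
  step : ∀ {u v} → arc D u v ≡ true → Walk D u v
  _∷ʷ_ : ∀ {u v w} → arc D u v ≡ true → Walk D v w → Walk D u w

-- Acyclic: no directed cycle (equivalently no nonempty closed walk).
Acyclic : Digraph → Set
Acyclic D = ∀ u → ¬ Walk D u u

InvertibleIn : Digraph → ℕ → Set
InvertibleIn D k = ∃ λ (Xs : Vec (VSet D) k) → Acyclic (invertAll D Xs)

InvEq : Digraph → ℕ → Set
InvEq D k = InvertibleIn D k × (∀ j → j < k → ¬ InvertibleIn D j)

dijoin : Digraph → Digraph → Digraph
dijoin L R = digraph (size L + size R) a
  where
  a : Fin (size L + size R) → Fin (size L + size R) → Bool
  a u v with splitAt (size L) u | splitAt (size L) v
  ... | inj₁ x | inj₁ y = arc L x y
  ... | inj₂ x | inj₂ y = arc R x y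
  ... | inj₁ _ | inj₂ _ = true
  ... | inj₂ _ | inj₁ _ = false

-- One inversion on each side suffices: invert the witness for L inside the
-- L-part and the witness for R inside the R-part; arcs between the parts still
-- all go from L to R, so a cycle would lie inside one part, which is acyclic.
-- Zero inversions fail because L sits inside the dijoin. For one inversion X,
-- suppose some arc a → b of L leaves X and some s ∈ V(R) lies in X; then
-- a → b → s → a is a directed triangle afterwards. Otherwise X meets L in a set
-- no arc leaves, or misses R; inverting a set no arc leaves keeps every cycle
-- (it lies wholly inside or wholly outside the set), so the cycle of L, resp.
-- of R, survives.
module Submission where

open import Defs
open import Data.Nat using (ℕ; suc; _+_; _<_; s≤s; z≤n)
open import Data.Fin using (Fin; splitAt; _↑ˡ_; _↑ʳ_)
open import Data.Fin.Properties using (splitAt-↑ˡ; splitAt-↑ʳ; join-splitAt; any?)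
open import Data.Bool using (Bool; true; false; _∧_)
open import Data.Bool.Properties using (∧-zeroʳ) renaming (_≟_ to _≟ᵇ_)
open import Data.Sum using (_⊎_; inj₁; inj₂; [_,_]′)
open import Data.Vec using ([]; _∷_)
open import Data.Product using (∃₂; _×_; _,_; proj₂)
open import Data.Empty using (⊥; ⊥-elim)
open import Function using (id; const)
open import Relation.Nullary using (¬_; yes; no)
open import Relation.Nullary.Decidable using (_×-dec_)
open import Relation.Binary.PropositionalEquality using (_≡_; refl; sym; trans; subst)

private
  variable
    D E : Digraph

ArcPreserving : (D E : Digraph) → (Fin (size D) → Fin (size E)) → Set
ArcPreserving D E f = ∀ {u v} → arc D u v ≡ true → arc E (f u) (f v) ≡ true

Walk-map : ∀ {f} → ArcPreserving D E f → ∀ {u v} → Walk D u v → Walk E (f u) (f v)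
Walk-map h (step e)  = step (h e)
Walk-map h (e ∷ʷ w) = h e ∷ʷ Walk-map h w

acyclic-pullback : ∀ {f} → ArcPreserving D E f → Acyclic E → Acyclic D
acyclic-pullback h acE u c = acE _ (Walk-map h c)

arcs-equal⇒preserving : (a : Fin (size D) → Fin (size D) → Bool) →
  (∀ u v → arc D u v ≡ a u v) → ArcPreserving D (digraph (size D) a) id
arcs-equal⇒preserving a eq {u} {v} e = trans (sym (eq u v)) e

Walk-snoc : ∀ {a b c} → Walk D a b → arc D b c ≡ true → Walk D a c
Walk-snoc (step e)  e′ = e ∷ʷ step e′
Walk-snoc (e ∷ʷ w) e′ = e ∷ʷ Walk-snoc w e′

module _ (D : Digraph) (X : VSet D) where

  invert-arc-keptˡ : ∀ {a b} → X a ≡ false → arc D a b ≡ true → arc (invert D X) a b ≡ true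
  invert-arc-keptˡ xa e rewrite xa = e

  invert-arc-keptʳ : ∀ {a b} → X b ≡ false → arc D a b ≡ true → arc (invert D X) a b ≡ true
  invert-arc-keptʳ {a} xb e rewrite xb | ∧-zeroʳ (X a) = e

  invert-arc-reversed : ∀ {a b} → X a ≡ true → X b ≡ true →
                        arc D a b ≡ true → arc (invert D X) b a ≡ true
  invert-arc-reversed xa xb e rewrite xa | xb = e

Closed : (D : Digraph) → VSet D → Set
Closed D X = ∀ {a b} → arc D a b ≡ true → X a ≡ true → X b ≡ true

Leaving : (D : Digraph) → VSet D → Fin (size D) → Fin (size D) → Set
Leaving D X a b = arc D a b ≡ true × X a ≡ true × X b ≡ false

closed-or-leaving : (X : VSet D) → Closed D X ⊎ ∃₂ (Leaving D X)
closed-or-leaving {D} X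
  with any? (λ a → any? (λ b → (arc D a b ≟ᵇ true) ×-dec (X a ≟ᵇ true) ×-dec (X b ≟ᵇ false)))
... | yes (a , b , leaving) = inj₂ (a , b , leaving)
... | no ¬leaving = inj₁ closed
  where
  closed : Closed D X
  closed {a} {b} e xa with X b in xb
  ... | true  = refl
  ... | false = ⊥-elim (¬leaving (a , b , e , xa , xb))

module _ {D : Digraph} {X : VSet D} (closed : Closed D X) where

  outside-of-closed : ∀ {a b} → arc D a b ≡ true → X b ≡ false → X a ≡ false
  outside-of-closed {a} e xb with X a in xa
  ... | false = refl
  ... | true  with trans (sym (closed e xa)) xb
  ... | ()

  walk-outside-closed : ∀ {a b} → Walk D a b → X b ≡ false →
                        X a ≡ false × Walk (invert D X) a b
  walk-outside-closed (step e) xb =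
    let xa = outside-of-closed e xb in xa , step (invert-arc-keptˡ D X xa e)
  walk-outside-closed (e ∷ʷ w) xb with walk-outside-closed w xb
  ... | xc , w′ = let xa = outside-of-closed e xc in xa , invert-arc-keptˡ D X xa e ∷ʷ w′

  walk-inside-closed : ∀ {a b} → Walk D a b → X a ≡ true →
                       X b ≡ true × Walk (invert D X) b a
  walk-inside-closed (step e) xa =
    let xb = closed e xa in xb , step (invert-arc-reversed D X xa xb e)
  walk-inside-closed (e ∷ʷ w) xa with walk-inside-closed w (closed e xa)
  ... | xb , w′ = xb , Walk-snoc w′ (invert-arc-reversed D X xa (closed e xa) e)

  invert-closed-reflects-acyclic : Acyclic (invert D X) → Acyclic D
  invert-closed-reflects-acyclic ac u c with X u in xu
  ... | true  = ac u (proj₂ (walk-inside-closed c xu))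
  ... | false = ac u (proj₂ (walk-outside-closed c xu))

data Split (m n : ℕ) : Fin (m + n) → Set where
  left  : ∀ u → Split m n (u ↑ˡ n)
  right : ∀ r → Split m n (m ↑ʳ r)

split : ∀ m n (w : Fin (m + n)) → Split m n w
split m n w with splitAt m w | join-splitAt m n w
... | inj₁ u | eq = subst (Split m n) eq (left u)
... | inj₂ r | eq = subst (Split m n) eq (right r)

module _ (L R : Digraph) where
  private
    m = size L
    n = size R

  dijoin-arc-ll : ∀ u v → arc (dijoin L R) (u ↑ˡ n) (v ↑ˡ n) ≡ arc L u v
  dijoin-arc-ll u v rewrite splitAt-↑ˡ m u n | splitAt-↑ˡ m v n = refl

  dijoin-arc-lr : ∀ u r → arc (dijoin L R) (u ↑ˡ n) (m ↑ʳ r) ≡ true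
  dijoin-arc-lr u r rewrite splitAt-↑ˡ m u n | splitAt-↑ʳ m n r = refl

  dijoin-arc-rl : ∀ r u → arc (dijoin L R) (m ↑ʳ r) (u ↑ˡ n) ≡ false
  dijoin-arc-rl r u rewrite splitAt-↑ˡ m u n | splitAt-↑ʳ m n r = refl

  dijoin-arc-rr : ∀ r s → arc (dijoin L R) (m ↑ʳ r) (m ↑ʳ s) ≡ arc R r s
  dijoin-arc-rr r s rewrite splitAt-↑ʳ m n r | splitAt-↑ʳ m n s = refl

  ↑ˡ-preserving : ArcPreserving L (dijoin L R) (_↑ˡ n)
  ↑ˡ-preserving {u} {v} = trans (dijoin-arc-ll u v)

  no-arc-right-to-left : ∀ {r u} → arc (dijoin L R) (m ↑ʳ r) (u ↑ˡ n) ≡ true → ⊥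
  no-arc-right-to-left {r} {u} e with trans (sym (dijoin-arc-rl r u)) e
  ... | ()

  no-walk-right-to-left : ∀ {r u} → Walk (dijoin L R) (m ↑ʳ r) (u ↑ˡ n) → ⊥
  no-walk-right-to-left (step e) = no-arc-right-to-left e
  no-walk-right-to-left (_∷ʷ_ {v = c} e w) with split m n c
  ... | left _  = no-arc-right-to-left e
  ... | right _ = no-walk-right-to-left w

  walk-left : ∀ {x u} → Walk (dijoin L R) (x ↑ˡ n) (u ↑ˡ n) → Walk L x u
  walk-left {x} {u} (step e) = step (trans (sym (dijoin-arc-ll x u)) e)
  walk-left {x} (_∷ʷ_ {v = c} e w) with split m n c
  ... | left y  = trans (sym (dijoin-arc-ll x y)) e ∷ʷ walk-left w
  ... | right _ = ⊥-elim (no-walk-right-to-left w)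

  walk-right : ∀ {r s} → Walk (dijoin L R) (m ↑ʳ r) (m ↑ʳ s) → Walk R r s
  walk-right {r} {s} (step e) = step (trans (sym (dijoin-arc-rr r s)) e)
  walk-right {r} (_∷ʷ_ {v = c} e w) with split m n c
  ... | left _  = ⊥-elim (no-arc-right-to-left e)
  ... | right t = trans (sym (dijoin-arc-rr r t)) e ∷ʷ walk-right w

  dijoin-acyclic : Acyclic L → Acyclic R → Acyclic (dijoin L R)
  dijoin-acyclic acL acR w c with split m n w
  ... | left x  = acL x (walk-left c)
  ... | right r = acR r (walk-right c)

module _ (L R : Digraph) where
  private
    m = size L
    n = size R

  onLeft : VSet L → VSet (dijoin L R)
  onLeft X w = [ X , const false ]′ (splitAt m w)

  onRight : VSet R → VSet (dijoin L R)
  onRight Y w = [ const false , Y ]′ (splitAt m w)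

  invert-onLeft-onRight : (X : VSet L) (Y : VSet R) → ∀ u v →
    arc (invertAll (dijoin L R) (onLeft X ∷ onRight Y ∷ [])) u v
      ≡ arc (dijoin (invert L X) (invert R Y)) u v
  invert-onLeft-onRight X Y u v with split m n u | split m n v
  ... | left x  | left y  rewrite splitAt-↑ˡ m x n | splitAt-↑ˡ m y n = refl
  ... | left x  | right s rewrite splitAt-↑ˡ m x n | splitAt-↑ʳ m n s | ∧-zeroʳ (X x) = refl
  ... | right r | left y  rewrite splitAt-↑ʳ m n r | splitAt-↑ˡ m y n | ∧-zeroʳ (Y r) = refl
  ... | right r | right s rewrite splitAt-↑ʳ m n r | splitAt-↑ʳ m n s = refl

  dijoin-invertible-in-2 : ∀ X Y → Acyclic (invert L X) → Acyclic (invert R Y) →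
                           InvertibleIn (dijoin L R) 2
  dijoin-invertible-in-2 X Y acL acR =
    onLeft X ∷ onRight Y ∷ [] ,
    acyclic-pullback (arcs-equal⇒preserving _ (invert-onLeft-onRight X Y))
                     (dijoin-acyclic (invert L X) (invert R Y) acL acR)

module _ (L R : Digraph) (X : VSet (dijoin L R)) where
  private
    m = size L
    n = size R
    D′ = invert (dijoin L R) X
    XL : VSet L
    XL u = X (u ↑ˡ n)
    XR : VSet R
    XR r = X (m ↑ʳ r)

    ↑ˡ-preserving-inverted : ArcPreserving (invert L XL) D′ (_↑ˡ n)
    ↑ˡ-preserving-inverted {u} {v} rewrite dijoin-arc-ll L R u v | dijoin-arc-ll L R v u = id

    ↑ʳ-preserving-inverted : ArcPreserving (invert R XR) D′ (m ↑ʳ_)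
    ↑ʳ-preserving-inverted {r} {s} rewrite dijoin-arc-rr L R r s | dijoin-arc-rr L R s r = id

    triangle : ∀ {a b s} → Leaving L XL a b → XR s ≡ true → Walk D′ (a ↑ˡ n) (a ↑ˡ n)
    triangle {a} {b} {s} (e , xa , xb) xs =
      invert-arc-keptʳ (dijoin L R) X xb (trans (dijoin-arc-ll L R a b) e) ∷ʷ
      (invert-arc-keptˡ (dijoin L R) X xb (dijoin-arc-lr L R b s) ∷ʷ
       step (invert-arc-reversed (dijoin L R) X xa xs (dijoin-arc-lr L R a s)))

  dijoin-not-inverted-once : ¬ Acyclic L → ¬ Acyclic R → ¬ Acyclic D′
  dijoin-not-inverted-once cyclicL cyclicR ac with closed-or-leaving XL
  ... | inj₁ closedL = cyclicL
        (invert-closed-reflects-acyclic closedL (acyclic-pullback ↑ˡ-preserving-inverted ac))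
  ... | inj₂ (_ , _ , leaving) with any? (λ s → XR s ≟ᵇ true)
  ...   | yes (_ , xs) = ac _ (triangle leaving xs)
  ...   | no ¬xs = cyclicR
          (invert-closed-reflects-acyclic (λ {a} _ xa → ⊥-elim (¬xs (a , xa)))
            (acyclic-pullback ↑ʳ-preserving-inverted ac))

inv-1⇒cyclic : InvEq D 1 → ¬ Acyclic D
inv-1⇒cyclic (_ , minimal) ac = minimal 0 (s≤s z≤n) ([] , ac)

corollary3p2 : (L R : Digraph) → IsOriented L → IsOriented R →
    InvEq L 1 → InvEq R 1 → InvEq (dijoin L R) 2
corollary3p2 L R _ _ invL@((X ∷ [] , acL) , _) invR@((Y ∷ [] , acR) , _) =
  dijoin-invertible-in-2 L R X Y acL acR , fewer-fail
  where
  fewer-fail : ∀ j → j < 2 → ¬ InvertibleIn (dijoin L R) j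
  fewer-fail 0 _ ([] , ac) =
    inv-1⇒cyclic invL (acyclic-pullback (↑ˡ-preserving L R) ac)
  fewer-fail 1 _ (Z ∷ [] , ac) =
    dijoin-not-inverted-once L R Z (inv-1⇒cyclic invL) (inv-1⇒cyclic invR) ac
  fewer-fail (suc (suc _)) (s≤s (s≤s ()))
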